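{- If $G$ is a connected subcubic graph of order $n\geq 6$, then $$C(G)\leq \begin{cases}\frac{7}{12}+\frac{12}{12n}, & \text{if } n\equiv 0 \pmod 4,\\ \frac{7}{12}+\frac{13}{12n}, & \text{if } n\equiv 1 \pmod 4,\\ \frac{7}{12}+\frac{14}{12n}, & \text{if } n\equiv 2 \pmod 4,\\ \frac{7}{12}+\frac{11}{12n}, & \text{if } n\equiv 3 \pmod 4.\end{cases}$$
   Context: All graphs are finite and simple. A graph is subcubic if its maximum degree is at most $3$. For a vertex $u$ of a graph $G$ with neighborhood $N_G(u)$ and degree $d_G(u)$, the clustering coefficient of $u$ is $C_u(G)=m(G[N_G(u)])/\binom{d_G(u)}{2}$ if $d_G(u)\geq 2$, and $C_u(G)=0$ otherwise, where $m(G[N_G(u)])$ is the number of edges of the subgraph induced by $N_G(u)$. The clustering coefficient of $G$ is $C(G)=\frac{1}{n(G)}\sum_{u\in V(G)}C_u(G)$, where $n(G)$ is the order of $G$. -}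

module Defs where

open import Data.Nat as ℕ using (ℕ; zero; suc; _≤_; NonZero; _%_)
open import Data.Nat.Combinatorics using (_C_; nC1≡n; nCk+nC[k+1]≡[n+1]C[k+1])
open import Data.Bool using (Bool; true; false; if_then_else_; _∧_)
open import Data.Fin using (Fin; toℕ; _<?_)
open import Data.List using (List; allFin; map; concatMap)
open import Data.Nat.ListAction using (sum)
open import Data.Integer using (+_)
open import Data.Rational as ℚ using (ℚ; _/_; 0ℚ)
open import Relation.Binary.PropositionalEquality using (_≡_; subst; sym)
open import Relation.Nullary.Decidable using (⌊_⌋)

record Graph (n : ℕ) : Set where
  field
    adj    : Fin n → Fin n → Bool
    symm   : ∀ u v → adj u v ≡ adj v u
    irrefl : ∀ u → adj u u ≡ false
open Graph public

ind : Bool → ℕ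
ind true  = 1
ind false = 0

degree : ∀ {n} → Graph n → Fin n → ℕ
degree G u = sum (map (λ v → ind (adj G u v)) (allFin _))

nbrEdges : ∀ {n} → Graph n → Fin n → ℕ
nbrEdges G u =
  sum (concatMap (λ v → map (λ w →
         ind (⌊ v <? w ⌋ ∧ adj G u v ∧ adj G u w ∧ adj G v w))
       (allFin _)) (allFin _))

C2-nonZero : ∀ k → NonZero (suc (suc k) C 2)
C2-nonZero k = subst NonZero
  (nCk+nC[k+1]≡[n+1]C[k+1] (suc k) 1)
  (subst (λ x → NonZero (ℕ._+_ x (suc k C 2))) (sym (nC1≡n (suc k))) _)

clusteringAt' : ℕ → ℕ → ℚ
clusteringAt' zero          m = 0ℚ
clusteringAt' (suc zero)    m = 0ℚ
clusteringAt' (suc (suc k)) m = (+ m / (suc (suc k) C 2)) {{C2-nonZero k}}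

clusteringAt : ∀ {n} → Graph n → Fin n → ℚ
clusteringAt G u = clusteringAt' (degree G u) (nbrEdges G u)

sumℚ : List ℚ → ℚ
sumℚ = Data.List.foldr ℚ._+_ 0ℚ

clustering : ∀ {n} → Graph n → ℚ
clustering {zero}  G = 0ℚ
clustering {suc n} G = ℚ._*_ (+ 1 / suc n) (sumℚ (map (clusteringAt G) (allFin _)))

data Reach {n} (G : Graph n) : Fin n → Fin n → Set where
  here : ∀ {u} → Reach G u u
  step : ∀ {u v w} → adj G u v ≡ true → Reach G v w → Reach G u w

Connected : ∀ {n} → Graph n → Set
Connected G = ∀ u v → Reach G u v

Subcubic : ∀ {n} → Graph n → Set
Subcubic G = ∀ u → degree G u ≤ 3

boundNum : ℕ → ℕ
boundNum n with n % 4
... | 0 = 12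
... | 1 = 13
... | 2 = 14
... | _ = 11

-- the bound 7/12 + c/(12n)  (n = 0 never used)
bound : ℕ → ℚ
bound zero    = 0ℚ
bound (suc n) = ℚ._+_ (+ 7 / 12) (+ boundNum (suc n) / (12 ℕ.* suc n))

module Submission where

-- For a vertex u of degree at most 3 the number 3·C_u is a
-- natural number, thriceC (deg u) (m u), so C(G) = 4·Σ_u 3C_u / 12n and the
-- theorem reduces to the integer inequality  4·Σ_u 3C_u ≤ 7n + 14,  sharpened
-- by rounding according to n mod 4.  That inequality is the sum of
--  (1) a global count  n + t(G) ≤ e(G) + 1  (t triangles, e edges), proved by
--      growing a connected vertex set one neighbour at a time: a vertex with
--      d ≥ 1 neighbours in the set adds d edges and at most d - 1 triangles,
--      because a connected subcubic graph on ≥ 5 vertices has no K4;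
--  (2) seven copies of a discharging inequality: each degree-2 vertex in a
--      triangle sends one unit to each neighbour of degree 3 (one exists, as
--      three degree-2 vertices never form a triangle), and then every vertex
--      satisfies  12·3C_u + 21·d(u) + received(u) ≤ 63 + 14·m(u) + sent(u).

open import Defs

import Data.Nat
open import Data.Nat as ℕ using (ℕ; zero; suc; _+_; _*_; _∸_; _%_; _≤_; _<_; z≤n; s≤s)
open import Data.Nat.Properties hiding (_≟_; _<?_)
open import Data.Nat.ListAction using (sum)
open import Data.Nat.ListAction.Properties using (sum-++)
open import Data.Nat.Tactic.RingSolver using (solve-∀)
open import Data.Nat.DivMod using (_/_; m≡m%n+[m/n]*n; m%n<n; m*n/n≡m; /-monoˡ-≤; %-distribˡ-+; %-distribˡ-*)
open import Data.Fin using (Fin; zero; suc; fromℕ<; _<?_)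
open import Data.Fin.Properties using (_≟_; pigeonhole)
import Data.Fin.Properties as Finₚ
open import Data.Bool using (Bool; true; false; _∧_; _∨_; not; if_then_else_)
import Data.Bool as Bool
open import Data.Bool.Properties using (¬-not; ∨-zeroʳ; ∧-conicalʳ)
open import Data.List using (List; []; _∷_; map; tabulate; allFin; concatMap; length; filter; lookup)
open import Data.List.Relation.Unary.All using (All; []; _∷_)
import Data.List.Relation.Unary.All as All
open import Data.List.Relation.Unary.All.Properties using (¬Any⇒All¬)
open import Data.List.Relation.Unary.AllPairs using (AllPairs; []; _∷_)
import Data.List.Relation.Unary.AllPairs as AllPairs
open import Data.List.Relation.Unary.Unique.Propositional using (Unique)
open import Data.List.Membership.Propositional using (_∈_)
import Data.List.Membership.DecPropositional as DecMembership
open import Data.List.Membership.Propositional.Properties using (∈-filter⁺; ∈-filter⁻; ∈-allFin)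
open import Data.List.Relation.Unary.Any using (here; there; index)
open import Data.List.Relation.Unary.Any.Properties using (lookup-index)
open import Data.Product using (∃; ∃₂; _×_; _,_; proj₂)
import Data.Integer as ℤ using (+_; _+_; _≤_; +≤+)
import Data.Integer.Properties as ℤ using (pos-*; pos-+)
import Data.Rational
open import Data.Rational using (ℚ)
import Data.Rational as ℚ using (_/_; toℚᵘ)
import Data.Rational.Properties as ℚ using (toℚᵘ-fromℚᵘ; toℚᵘ-homo-+; toℚᵘ-homo-*; toℚᵘ-cancel-≤)
open import Data.Rational.Unnormalised using (ℚᵘ; mkℚᵘ; *≡*; *≤*; _≃_)
import Data.Rational.Unnormalised as ℚᵘ using (_+_; _*_; _≤_)
import Data.Rational.Unnormalised.Properties as ℚᵘ using (≃-reflexive; ≃-trans; ≃-sym; +-cong; *-cong; ≤-respˡ-≃; ≤-respʳ-≃)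
open import Data.Empty using (⊥)
open import Function using (_∘_; id; case_of_)
open import Relation.Nullary using (¬_; yes; no; does; contradiction)
open import Relation.Unary using (Decidable)
open import Relation.Nullary.Decidable using (⌊_⌋; dec-true; dec-false)
open import Relation.Binary.Definitions using (tri<; tri≈; tri>)
open import Relation.Binary.PropositionalEquality

open import Algebra.Properties.Semiring.Sum +-*-semiring
  using (sum-cong-≗; ∑-distrib-+; ∑-comm; *-distribˡ-sum) renaming (sum to ∑)

-- Sums over Fin n.  The library sum is a right fold, so
-- ∑ {suc n} f = f zero + ∑ (f ∘ suc) holds definitionally.

∑-mono : ∀ {n} {f g : Fin n → ℕ} → (∀ i → f i ≤ g i) → ∑ f ≤ ∑ g
∑-mono {zero}  f≤g = z≤n
∑-mono {suc n} f≤g = +-mono-≤ (f≤g zero) (∑-mono (f≤g ∘ suc))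

∑-ones : ∀ n → ∑ {n} (λ _ → 1) ≡ n
∑-ones zero    = refl
∑-ones (suc n) = cong suc (∑-ones n)

∑-zeros : ∀ n → ∑ {n} (λ _ → 0) ≡ 0
∑-zeros zero    = refl
∑-zeros (suc n) = ∑-zeros n

∑≡0⇒≡0 : ∀ {n} (f : Fin n → ℕ) → ∑ f ≡ 0 → ∀ i → f i ≡ 0
∑≡0⇒≡0 f ∑f≡0 zero    = m+n≡0⇒m≡0 (f zero) ∑f≡0
∑≡0⇒≡0 f ∑f≡0 (suc i) = ∑≡0⇒≡0 (f ∘ suc) (m+n≡0⇒n≡0 (f zero) ∑f≡0) i

∑>0⇒>0 : ∀ {n} (f : Fin n → ℕ) → 0 < ∑ f → ∃ λ i → 0 < f i
∑>0⇒>0 {suc n} f ∑f>0 with f zero in eq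
... | suc _ = zero , subst (0 <_) (sym eq) (s≤s z≤n)
... | zero with ∑>0⇒>0 (f ∘ suc) ∑f>0
...   | i , fi>0 = suc i , fi>0

without : ∀ {n} → Fin n → (Fin n → ℕ) → Fin n → ℕ
without p f i = if does (i ≟ p) then 0 else f i

without-≢ : ∀ {n} {p i : Fin n} (f : Fin n → ℕ) → ¬ i ≡ p → without p f i ≡ f i
without-≢ {p = p} {i} f i≢p with i ≟ p
... | yes i≡p = contradiction i≡p i≢p
... | no _    = refl

∑-split : ∀ {n} (p : Fin n) (f : Fin n → ℕ) → ∑ f ≡ f p + ∑ (without p f)
∑-split zero    f = refl
∑-split (suc p) f = begin
  f zero + ∑ (f ∘ suc)                             ≡⟨ cong (f zero +_) (∑-split p (f ∘ suc)) ⟩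
  f zero + (f (suc p) + ∑ (without p (f ∘ suc)))   ≡⟨ +-comm-left (f zero) (f (suc p)) _ ⟩
  f (suc p) + (f zero + ∑ (without p (f ∘ suc)))   ∎
  where
  open ≡-Reasoning
  +-comm-left : ∀ a b c → a + (b + c) ≡ b + (a + c)
  +-comm-left = solve-∀

∑-point : ∀ {n} (p : Fin n) (f : Fin n → ℕ) → f p ≤ ∑ f
∑-point p f = subst (f p ≤_) (sym (∑-split p f)) (m≤m+n (f p) _)

∑-linear : ∀ {n} x y (f g h : Fin n → ℕ) → ∑ (λ u → x * f u + y * g u + h u) ≡ x * ∑ f + y * ∑ g + ∑ h
∑-linear x y f g h = begin
  ∑ (λ u → x * f u + y * g u + h u)          ≡⟨ ∑-distrib-+ (λ u → x * f u + y * g u) h ⟩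
  ∑ (λ u → x * f u + y * g u) + ∑ h          ≡⟨ cong (_+ ∑ h) (∑-distrib-+ (λ u → x * f u) (λ u → y * g u)) ⟩
  ∑ (λ u → x * f u) + ∑ (λ u → y * g u) + ∑ h ≡⟨ cong₂ (λ p q → p + q + ∑ h) (*-distribˡ-sum x f) (*-distribˡ-sum y g) ⟨
  x * ∑ f + y * ∑ g + ∑ h                    ∎
  where open ≡-Reasoning

δ : ∀ {n} → Fin n → Fin n → ℕ
δ p i = if does (i ≟ p) then 1 else 0

∑-δ : ∀ {n} (p : Fin n) (h : Fin n → ℕ) → ∑ (λ i → δ p i * h i) ≡ h p
∑-δ {n} p h = begin
  ∑ g                     ≡⟨ ∑-split p g ⟩
  g p + ∑ (without p g)   ≡⟨ cong₂ _+_ at-p (trans (sum-cong-≗ off-p) (∑-zeros n)) ⟩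
  h p + 0                 ≡⟨ +-identityʳ (h p) ⟩
  h p                     ∎
  where
  open ≡-Reasoning
  g : Fin n → ℕ
  g i = δ p i * h i
  at-p : g p ≡ h p
  at-p with p ≟ p
  ... | yes _  = +-identityʳ (h p)
  ... | no p≢p = contradiction refl p≢p
  off-p : ∀ i → without p g i ≡ 0
  off-p i with i ≟ p
  ... | yes _ = refl
  ... | no _  = refl

sum-unique≤∑ : ∀ {n} (f : Fin n → ℕ) {xs : List (Fin n)} → Unique xs → sum (map f xs) ≤ ∑ f
sum-unique≤∑ f {[]}     []             = z≤n
sum-unique≤∑ f {x ∷ xs} (x∉xs ∷ uniq) = begin
  f x + sum (map f xs)                ≡⟨ cong (f x +_) (sum-avoiding x∉xs) ⟩
  f x + sum (map (without x f) xs)    ≤⟨ +-monoʳ-≤ (f x) (sum-unique≤∑ (without x f) uniq) ⟩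
  f x + ∑ (without x f)               ≡⟨ ∑-split x f ⟨
  ∑ f                                 ∎
  where
  open ≤-Reasoning
  sum-avoiding : ∀ {ys} → All (λ y → ¬ x ≡ y) ys → sum (map f ys) ≡ sum (map (without x f) ys)
  sum-avoiding []           = refl
  sum-avoiding (x≢y ∷ x≢ys) = cong₂ _+_ (sym (without-≢ f (x≢y ∘ sym))) (sum-avoiding x≢ys)

sum-tabulate : ∀ {A : Set} {n} (f : A → ℕ) (g : Fin n → A) → sum (map f (tabulate g)) ≡ ∑ (f ∘ g)
sum-tabulate {n = zero}  f g = refl
sum-tabulate {n = suc n} f g = cong (f (g zero) +_) (sum-tabulate f (g ∘ suc))

sum-allFin : ∀ {n} (f : Fin n → ℕ) → sum (map f (allFin n)) ≡ ∑ f
sum-allFin f = sum-tabulate f id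

sum-ones : ∀ {A : Set} (xs : List A) → sum (map (λ _ → 1) xs) ≡ length xs
sum-ones []       = refl
sum-ones (x ∷ xs) = cong suc (sum-ones xs)

members : ∀ {n} → (Fin n → Bool) → List (Fin n)
members P = filter (λ i → P i Bool.≟ true) (allFin _)

size : ∀ {n} → (Fin n → Bool) → ℕ
size P = ∑ (λ i → ind (P i))

∈-members⁺ : ∀ {n} {P : Fin n → Bool} {i} → P i ≡ true → i ∈ members P
∈-members⁺ {P = P} {i} Pi = ∈-filter⁺ (λ i → P i Bool.≟ true) (∈-allFin i) Pi

∈-members⁻ : ∀ {n} {P : Fin n → Bool} {i} → i ∈ members P → P i ≡ true
∈-members⁻ {n} {P} i∈ = proj₂ (∈-filter⁻ (λ i → P i Bool.≟ true) {xs = allFin n} i∈)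

∑-members : ∀ {n} (P : Fin n → Bool) (g : Fin n → ℕ) → ∑ (λ i → ind (P i) * g i) ≡ sum (map g (members P))
∑-members {n} P g = trans (sym (sum-allFin (λ i → ind (P i) * g i))) (over (allFin n))
  where
  over : ∀ xs → sum (map (λ i → ind (P i) * g i) xs) ≡ sum (map g (filter (λ i → P i Bool.≟ true) xs))
  over []       = refl
  over (x ∷ xs) with P x
  ... | true  = cong₂ _+_ (+-identityʳ (g x)) (over xs)
  ... | false = over xs

size≡length : ∀ {n} (P : Fin n → Bool) → size P ≡ length (members P)
size≡length P = begin
  ∑ (λ i → ind (P i))           ≡⟨ sum-cong-≗ (λ i → sym (*-identityʳ (ind (P i)))) ⟩
  ∑ (λ i → ind (P i) * 1)       ≡⟨ ∑-members P (λ _ → 1) ⟩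
  sum (map (λ _ → 1) (members P)) ≡⟨ sum-ones (members P) ⟩
  length (members P)            ∎
  where open ≡-Reasoning

covering-length : ∀ {n} (xs : List (Fin n)) → (∀ z → z ∈ xs) → n ≤ length xs
covering-length {n} xs covers with n ℕ.≤? length xs
... | yes n≤len = n≤len
... | no  n≰len with pigeonhole (≰⇒> n≰len) (λ z → index (covers z))
...   | i , j , i<j , same-index = contradiction i≡j (Finₚ.<⇒≢ i<j)
  where
  i≡j : i ≡ j
  i≡j = trans (lookup-index (covers i)) (trans (cong (lookup xs) same-index) (sym (lookup-index (covers j))))

sum-concatMap : ∀ {A : Set} (k : A → List ℕ) (xs : List A) → sum (concatMap k xs) ≡ sum (map (sum ∘ k) xs)
sum-concatMap k []       = refl
sum-concatMap k (x ∷ xs) = trans (sum-++ (k x) (concatMap k xs)) (cong (sum (k x) +_) (sum-concatMap k xs))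

lt : ∀ {n} → Fin n → Fin n → ℕ
lt v w = ind ⌊ v <? w ⌋

∑∑-symmetric : ∀ {n} (g : Fin n → Fin n → ℕ) → (∀ v w → g v w ≡ g w v) → (∀ v → g v v ≡ 0) →
  ∑ (λ v → ∑ (λ w → g v w)) ≡ 2 * ∑ (λ v → ∑ (λ w → lt v w * g v w))
∑∑-symmetric g g-sym g-diag = begin
  ∑ (λ v → ∑ (λ w → g v w))                                      ≡⟨ sum-cong-≗ (λ v → sum-cong-≗ (split v)) ⟩
  ∑ (λ v → ∑ (λ w → lt v w * g v w + lt w v * g w v))            ≡⟨ sum-cong-≗ (λ v → ∑-distrib-+ (λ w → lt v w * g v w) (λ w → lt w v * g w v)) ⟩
  ∑ (λ v → ∑ (λ w → lt v w * g v w) + ∑ (λ w → lt w v * g w v))  ≡⟨ ∑-distrib-+ (λ v → ∑ (λ w → lt v w * g v w)) (λ v → ∑ (λ w → lt w v * g w v)) ⟩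
  U + ∑ (λ v → ∑ (λ w → lt w v * g w v))                         ≡⟨ cong (U +_) (∑-comm (λ v w → lt w v * g w v)) ⟩
  U + U                                                           ≡⟨ cong (U +_) (+-identityʳ U) ⟨
  2 * U                                                           ∎
  where
  open ≡-Reasoning
  U = ∑ (λ v → ∑ (λ w → lt v w * g v w))
  split : ∀ v w → g v w ≡ lt v w * g v w + lt w v * g w v
  split v w with Finₚ.<-cmp v w | v <? w | w <? v
  ... | tri< _ _ _       | yes _   | no _    = sym (trans (+-identityʳ _) (+-identityʳ _))
  ... | tri> _ _ _       | no _    | yes _   = sym (trans (+-identityʳ _) (g-sym w v))
  ... | tri≈ _ refl _    | b₁      | b₂      rewrite g-diag v = sym (cong₂ _+_ (*-zeroʳ (ind ⌊ b₁ ⌋)) (*-zeroʳ (ind ⌊ b₂ ⌋)))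
  ... | tri< v<w _ _     | no v≮w  | _       = contradiction v<w v≮w
  ... | tri< v<w _ _     | yes _   | yes w<v = contradiction w<v (Finₚ.<-asym v<w)
  ... | tri> _ _ w<v     | _       | no w≮v  = contradiction w<v w≮v
  ... | tri> _ _ w<v     | yes v<w | yes _   = contradiction w<v (Finₚ.<-asym v<w)

ind-∧ : ∀ x y → ind (x ∧ y) ≡ ind x * ind y
ind-∧ true  y = sym (+-identityʳ (ind y))
ind-∧ false y = refl

ind≤1 : ∀ x → ind x ≤ 1
ind≤1 true  = s≤s z≤n
ind≤1 false = z≤n

module Counting {n : ℕ} (G : Graph n) where

  open DecMembership (_≟_ {n}) using (_∈?_)

  Adj : Fin n → Fin n → Set
  Adj u v = adj G u v ≡ true

  Adj-sym : ∀ {u v} → Adj u v → Adj v u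
  Adj-sym {u} {v} uv = trans (symm G v u) uv

  Adj⇒≢ : ∀ {u v} → Adj u v → ¬ u ≡ v
  Adj⇒≢ {u} uu refl = case trans (sym uu) (irrefl G u) of λ ()

  a : Fin n → Fin n → ℕ
  a u v = ind (adj G u v)

  a-sym : ∀ u v → a u v ≡ a v u
  a-sym u v = cong ind (symm G u v)

  a-irrefl : ∀ u → a u u ≡ 0
  a-irrefl u = cong ind (irrefl G u)

  Adj⇒a≡1 : ∀ {u v} → Adj u v → a u v ≡ 1
  Adj⇒a≡1 uv = cong ind uv

  deg : Fin n → ℕ
  deg u = size (adj G u)

  degree≡deg : ∀ u → degree G u ≡ deg u
  degree≡deg u = sum-allFin (a u)

  nbrs : Fin n → List (Fin n)
  nbrs u = members (adj G u)

  deg≡length : ∀ u → deg u ≡ length (nbrs u)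
  deg≡length u = size≡length (adj G u)

  pairs : List (Fin n) → ℕ
  pairs xs = sum (map (λ v → sum (map (a v) xs)) xs)

  pairsIn : (Fin n → Bool) → ℕ
  pairsIn P = ∑ (λ v → ind (P v) * ∑ (λ w → ind (P w) * a v w))

  pairsIn≡pairs : ∀ P → pairsIn P ≡ pairs (members P)
  pairsIn≡pairs P = begin
    ∑ (λ v → ind (P v) * ∑ (λ w → ind (P w) * a v w))       ≡⟨ sum-cong-≗ (λ v → cong (ind (P v) *_) (∑-members P (a v))) ⟩
    ∑ (λ v → ind (P v) * sum (map (a v) (members P)))        ≡⟨ ∑-members P (λ v → sum (map (a v) (members P))) ⟩
    pairs (members P)                                        ∎
    where open ≡-Reasoning

  wedges : Fin n → ℕ
  wedges u = pairsIn (adj G u)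

  wedges≡2*nbrEdges : ∀ u → wedges u ≡ 2 * nbrEdges G u
  wedges≡2*nbrEdges u = begin
    ∑ (λ v → a u v * ∑ (λ w → a u w * a v w))     ≡⟨ sum-cong-≗ (λ v → *-distribˡ-sum (a u v) (λ w → a u w * a v w)) ⟩
    ∑ (λ v → ∑ (λ w → g v w))                      ≡⟨ ∑∑-symmetric g g-sym g-diag ⟩
    2 * ∑ (λ v → ∑ (λ w → lt v w * g v w))         ≡⟨ cong (2 *_) nbrEdges≡ ⟨
    2 * nbrEdges G u                               ∎
    where
    open ≡-Reasoning
    g : Fin n → Fin n → ℕ
    g v w = a u v * (a u w * a v w)
    g-sym : ∀ v w → g v w ≡ g w v
    g-sym v w = trans (cong (λ x → a u v * (a u w * x)) (a-sym v w)) (swap (a u v) (a u w) (a w v))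
      where swap : ∀ x y z → x * (y * z) ≡ y * (x * z)
            swap = solve-∀
    g-diag : ∀ v → g v v ≡ 0
    g-diag v = trans (cong (λ x → a u v * (a u v * x)) (a-irrefl v)) (trans (cong (a u v *_) (*-zeroʳ (a u v))) (*-zeroʳ (a u v)))
    entry : ∀ v w → ind (⌊ v <? w ⌋ ∧ adj G u v ∧ adj G u w ∧ adj G v w) ≡ lt v w * g v w
    entry v w = trans (ind-∧ ⌊ v <? w ⌋ _) (cong (lt v w *_) (trans (ind-∧ (adj G u v) _) (cong (a u v *_) (ind-∧ (adj G u w) (adj G v w)))))
    nbrEdges≡ : nbrEdges G u ≡ ∑ (λ v → ∑ (λ w → lt v w * g v w))
    nbrEdges≡ = begin
      nbrEdges G u                                    ≡⟨ sum-concatMap _ (allFin n) ⟩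
      sum (map (λ v → sum (map (h v) (allFin n))) (allFin n))  ≡⟨ sum-allFin (λ v → sum (map (h v) (allFin n))) ⟩
      ∑ (λ v → sum (map (h v) (allFin n)))            ≡⟨ sum-cong-≗ (λ v → trans (sum-allFin (h v)) (sum-cong-≗ (entry v))) ⟩
      ∑ (λ v → ∑ (λ w → lt v w * g v w))              ∎
      where
      h : Fin n → Fin n → ℕ
      h v w = ind (⌊ v <? w ⌋ ∧ adj G u v ∧ adj G u w ∧ adj G v w)

  pairs-one : ∀ x → pairs (x ∷ []) ≡ 0
  pairs-one x = trans (+-identityʳ (a x x + 0)) (trans (+-identityʳ (a x x)) (a-irrefl x))

  pairs-two : ∀ x y → pairs (x ∷ y ∷ []) ≡ 2 * a x y
  pairs-two x y = arith (a x x) (a x y) (a y x) (a y y) (a-irrefl x) (a-sym y x) (a-irrefl y)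
    where
    arith : ∀ xx xy yx yy → xx ≡ 0 → yx ≡ xy → yy ≡ 0 →
            xx + (xy + 0) + (yx + (yy + 0) + 0) ≡ 2 * xy
    arith .0 xy .xy .0 refl refl refl = normalise xy
      where normalise : ∀ xy → 0 + (xy + 0) + (xy + (0 + 0) + 0) ≡ 2 * xy
            normalise = solve-∀

  pairs-three : ∀ x y z → pairs (x ∷ y ∷ z ∷ []) ≡ 2 * (a x y + a x z + a y z)
  pairs-three x y z = arith (a x x) (a x y) (a x z) (a y x) (a y y) (a y z) (a z x) (a z y) (a z z)
    (a-irrefl x) (a-irrefl y) (a-irrefl z) (a-sym y x) (a-sym z x) (a-sym z y)
    where
    arith : ∀ xx xy xz yx yy yz zx zy zz → xx ≡ 0 → yy ≡ 0 → zz ≡ 0 → yx ≡ xy → zx ≡ xz → zy ≡ yz →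
      xx + (xy + (xz + 0)) + (yx + (yy + (yz + 0)) + (zx + (zy + (zz + 0)) + 0)) ≡ 2 * (xy + xz + yz)
    arith .0 xy xz .xy .0 yz .xz .yz .0 refl refl refl refl refl refl = normalise xy xz yz
      where normalise : ∀ xy xz yz → 0 + (xy + (xz + 0)) + (xy + (0 + (yz + 0)) + (xz + (yz + (0 + 0)) + 0)) ≡ 2 * (xy + xz + yz)
            normalise = solve-∀

  nbr∈ : ∀ {u v} → Adj u v → v ∈ nbrs u
  nbr∈ = ∈-members⁺

  ∈nbrs : ∀ {u v} → v ∈ nbrs u → Adj u v
  ∈nbrs = ∈-members⁻

  wedges≡pairs : ∀ u → wedges u ≡ pairs (nbrs u)
  wedges≡pairs u = pairsIn≡pairs (adj G u)

  two-nbrs : ∀ u → deg u ≡ 2 → ∃₂ λ p q → nbrs u ≡ p ∷ q ∷ []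
  two-nbrs u d≡2 with nbrs u | deg≡length u
  ... | p ∷ q ∷ []        | _ = p , q , refl
  ... | []                | d≡0 = case trans (sym d≡2) d≡0 of λ ()
  ... | _ ∷ []            | d≡1 = case trans (sym d≡2) d≡1 of λ ()
  ... | _ ∷ _ ∷ _ ∷ _     | d≥3 = case trans (sym d≡2) d≥3 of λ ()

  nbrEdges-two : ∀ {u p q} → nbrs u ≡ p ∷ q ∷ [] → nbrEdges G u ≡ a p q
  nbrEdges-two {u} {p} {q} N≡pq = *-cancelˡ-≡ (nbrEdges G u) (a p q) 2
    (trans (sym (wedges≡2*nbrEdges u)) (trans (wedges≡pairs u) (trans (cong pairs N≡pq) (pairs-two p q))))

  adjacent-pair : List (Fin n) → Bool
  adjacent-pair (p ∷ q ∷ []) = adj G p q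
  adjacent-pair _            = false

  simplicial₂ : Fin n → Bool
  simplicial₂ u = adjacent-pair (nbrs u)

  simplicial₂-common : ∀ {u v} → simplicial₂ v ≡ true → Adj v u → ∃ λ w → Adj u w × Adj v w
  simplicial₂-common {u} {v} sv vu with nbrs v | nbr∈ vu | ∈nbrs {v}
  ... | p ∷ q ∷ [] | here refl         | adjacent = q , sv , adjacent (there (here refl))
  ... | p ∷ q ∷ [] | there (here refl) | adjacent = p , Adj-sym sv , adjacent (here refl)

  Clique : List (Fin n) → Set
  Clique = AllPairs Adj

  clique-unique : ∀ {K} → Clique K → Unique K
  clique-unique = AllPairs.map Adj⇒≢

  sum-adjacent : ∀ {p K} → All (Adj p) K → sum (map (a p) K) ≡ length K
  sum-adjacent []          = refl
  sum-adjacent (pq ∷ p~K) = cong₂ _+_ (Adj⇒a≡1 pq) (sum-adjacent p~K)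

  clique-count : ∀ {p K} → Clique K → p ∈ K → suc (sum (map (a p) K)) ≡ length K
  clique-count {p} (p~K ∷ _) (here refl) = cong suc (cong₂ _+_ (a-irrefl p) (sum-adjacent p~K))
  clique-count {p} {x ∷ K} (x~K ∷ cK) (there p∈K) =
    cong suc (trans (cong (_+ sum (map (a p) K)) (Adj⇒a≡1 (Adj-sym (All.lookup x~K p∈K)))) (clique-count cK p∈K))

  -- If every member of a clique K has degree below |K|, no edge leaves K,
  -- because a member already has its |K| - 1 neighbours inside K.
  clique-closed : ∀ {K} → Clique K → (∀ {p} → p ∈ K → deg p < length K) →
                  ∀ {p q} → p ∈ K → Adj p q → q ∈ K
  clique-closed {K} cK small {p} {q} p∈K pq with q ∈? K
  ... | yes q∈K = q∈K
  ... | no  q∉K = contradiction (small p∈K) (≤⇒≯ too-many)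
    where
    open ≤-Reasoning
    too-many : length K ≤ deg p
    too-many = begin
      length K                      ≡⟨ clique-count cK p∈K ⟨
      suc (sum (map (a p) K))       ≡⟨ cong (_+ sum (map (a p) K)) (Adj⇒a≡1 pq) ⟨
      sum (map (a p) (q ∷ K))       ≤⟨ sum-unique≤∑ (a p) (¬Any⇒All¬ K q∉K ∷ clique-unique cK) ⟩
      deg p                         ∎

  exit : ∀ {ℓ} {P : Fin n → Set ℓ} → Decidable P → ∀ {u z} → Reach G u z → P u → ¬ P z →
         ∃₂ λ p q → P p × ¬ P q × Adj p q
  exit P? here               Pu ¬Pz = contradiction Pu ¬Pz
  exit P? (step {v = v} uv walk) Pu ¬Pz with P? v
  ... | yes Pv  = exit P? walk Pv ¬Pz
  ... | no  ¬Pv = _ , _ , Pu , ¬Pv , uv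

  closed-covers : Connected G → ∀ {u K} → u ∈ K → (∀ {p q} → p ∈ K → Adj p q → q ∈ K) → ∀ z → z ∈ K
  closed-covers conn {u} {K} u∈K closed z with z ∈? K
  ... | yes z∈K = z∈K
  ... | no  z∉K with exit (_∈? K) (conn u z) u∈K z∉K
  ...   | p , q , p∈K , q∉K , pq = contradiction (closed p∈K pq) q∉K

  saturated-clique : Connected G → ∀ {u K} → Clique K → u ∈ K → (∀ {p} → p ∈ K → deg p < length K) → n ≤ length K
  saturated-clique conn {K = K} cK u∈K small = covering-length K (closed-covers conn u∈K (clique-closed cK small))

add-vertex : ∀ {n} {v : Fin n} {s s′ : Fin n → ℕ} → (∀ u → s′ u ≡ δ v u + s u) →
             ∀ F → ∑ (λ u → s′ u * F u) ≡ F v + ∑ (λ u → s u * F u)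
add-vertex {v = v} {s} {s′} s′≡ F = begin
  ∑ (λ u → s′ u * F u)                              ≡⟨ sum-cong-≗ (λ u → trans (cong (_* F u) (s′≡ u)) (*-distribʳ-+ (F u) (δ v u) (s u))) ⟩
  ∑ (λ u → δ v u * F u + s u * F u)                 ≡⟨ ∑-distrib-+ (λ u → δ v u * F u) (λ u → s u * F u) ⟩
  ∑ (λ u → δ v u * F u) + ∑ (λ u → s u * F u)       ≡⟨ cong (_+ ∑ (λ u → s u * F u)) (∑-δ v F) ⟩
  F v + ∑ (λ u → s u * F u)                         ∎
  where open ≡-Reasoning

∑-*-distrib-+ : ∀ {n} (s f g : Fin n → ℕ) → ∑ (λ u → s u * (f u + g u)) ≡ ∑ (λ u → s u * f u) + ∑ (λ u → s u * g u)
∑-*-distrib-+ s f g = trans (sum-cong-≗ (λ u → *-distribˡ-+ (s u) (f u) (g u))) (∑-distrib-+ (λ u → s u * f u) (λ u → s u * g u))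

-- Edges and triangles inside a weighted vertex set (weights 0/1 in use),
-- counted as ordered pairs and ordered triples, and how these counts
-- grow when one vertex is added.
module Growth {n : ℕ} (G : Graph n) where
  open Counting G

  D : (Fin n → ℕ) → Fin n → ℕ
  D s u = ∑ (λ w → s w * a u w)

  E : (Fin n → ℕ) → ℕ
  E s = ∑ (λ u → s u * D s u)

  C : (Fin n → ℕ) → Fin n → Fin n → ℕ
  C s u w = ∑ (λ x → s x * (a u x * a w x))

  B : (Fin n → ℕ) → Fin n → ℕ
  B s u = ∑ (λ w → s w * (a u w * C s u w))

  T : (Fin n → ℕ) → ℕ
  T s = ∑ (λ u → s u * B s u)

  module _ {v : Fin n} {s s′ : Fin n → ℕ} (s′≡ : ∀ u → s′ u ≡ δ v u + s u) where

    D-ins : ∀ u → D s′ u ≡ a u v + D s u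
    D-ins u = add-vertex s′≡ (a u)

    E-ins : E s′ ≡ E s + 2 * D s v
    E-ins = begin
      ∑ (λ u → s′ u * D s′ u)                          ≡⟨ sum-cong-≗ (λ u → cong (s′ u *_) (D-ins u)) ⟩
      ∑ (λ u → s′ u * (a u v + D s u))                 ≡⟨ add-vertex s′≡ (λ u → a u v + D s u) ⟩
      a v v + D s v + ∑ (λ u → s u * (a u v + D s u))  ≡⟨ cong₂ _+_ (cong (_+ D s v) (a-irrefl v)) (∑-*-distrib-+ s (λ u → a u v) (D s)) ⟩
      D s v + (∑ (λ u → s u * a u v) + E s)           ≡⟨ cong (λ d → D s v + (d + E s)) (sum-cong-≗ (λ u → cong (s u *_) (a-sym u v))) ⟩
      D s v + (D s v + E s)                            ≡⟨ arith (D s v) (E s) ⟩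
      E s + 2 * D s v                                  ∎
      where
      open ≡-Reasoning
      arith : ∀ d e → d + (d + e) ≡ e + 2 * d
      arith = solve-∀

    C-ins : ∀ u w → C s′ u w ≡ a u v * a w v + C s u w
    C-ins u w = add-vertex s′≡ (λ x → a u x * a w x)

    B-ins : ∀ u → B s′ u ≡ B s u + 2 * (a u v * C s u v)
    B-ins u = begin
      ∑ (λ w → s′ w * (a u w * C s′ u w))                     ≡⟨ sum-cong-≗ (λ w → cong (λ c → s′ w * (a u w * c)) (C-ins u w)) ⟩
      ∑ (λ w → s′ w * (a u w * (a u v * a w v + C s u w)))   ≡⟨ add-vertex s′≡ (λ w → a u w * (a u v * a w v + C s u w)) ⟩
      a u v * (a u v * a v v + C s u v) + ∑ (λ w → s w * (a u w * (a u v * a w v + C s u w)))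
        ≡⟨ cong₂ _+_ (cong (λ z → a u v * (a u v * z + C s u v)) (a-irrefl v)) (sum-cong-≗ λ w → split w) ⟩
      a u v * (a u v * 0 + C s u v) + ∑ (λ w → a u v * (s w * (a u w * a v w)) + s w * (a u w * C s u w))
        ≡⟨ cong (a u v * (a u v * 0 + C s u v) +_) (∑-distrib-+ (λ w → a u v * (s w * (a u w * a v w))) (λ w → s w * (a u w * C s u w))) ⟩
      a u v * (a u v * 0 + C s u v) + (∑ (λ w → a u v * (s w * (a u w * a v w))) + B s u)
        ≡⟨ cong (λ z → a u v * (a u v * 0 + C s u v) + (z + B s u)) (*-distribˡ-sum (a u v) (λ w → s w * (a u w * a v w))) ⟨
      a u v * (a u v * 0 + C s u v) + (a u v * C s u v + B s u)
        ≡⟨ arith (a u v) (C s u v) (B s u) ⟩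
      B s u + 2 * (a u v * C s u v)                             ∎
      where
      open ≡-Reasoning
      split : ∀ w → s w * (a u w * (a u v * a w v + C s u w)) ≡ a u v * (s w * (a u w * a v w)) + s w * (a u w * C s u w)
      split w = trans (cong (λ z → s w * (a u w * (a u v * z + C s u w))) (a-sym w v)) (ring (s w) (a u w) (a u v) (a v w) (C s u w))
        where ring : ∀ x y z t c → x * (y * (z * t + c)) ≡ z * (x * (y * t)) + x * (y * c)
              ring = solve-∀
      arith : ∀ x c b → x * (x * 0 + c) + (x * c + b) ≡ b + 2 * (x * c)
      arith = solve-∀

    T-ins : T s′ ≡ T s + 3 * B s v
    T-ins = begin
      ∑ (λ u → s′ u * B s′ u)                                      ≡⟨ sum-cong-≗ (λ u → cong (s′ u *_) (B-ins u)) ⟩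
      ∑ (λ u → s′ u * (B s u + 2 * (a u v * C s u v)))             ≡⟨ add-vertex s′≡ (λ u → B s u + 2 * (a u v * C s u v)) ⟩
      B s v + 2 * (a v v * C s v v) + ∑ (λ u → s u * (B s u + 2 * (a u v * C s u v)))
        ≡⟨ cong₂ _+_ (cong (λ z → B s v + 2 * (z * C s v v)) (a-irrefl v)) (∑-*-distrib-+ s (B s) (λ u → 2 * (a u v * C s u v))) ⟩
      B s v + 2 * (0 * C s v v) + (T s + ∑ (λ u → s u * (2 * (a u v * C s u v))))
        ≡⟨ cong (λ z → B s v + 2 * (0 * C s v v) + (T s + z)) twice-B ⟩
      B s v + 2 * (0 * C s v v) + (T s + 2 * B s v)
        ≡⟨ arith (B s v) (C s v v) (T s) ⟩
      T s + 3 * B s v                                               ∎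
      where
      open ≡-Reasoning
      C-sym : ∀ u w → C s u w ≡ C s w u
      C-sym u w = sum-cong-≗ (λ x → cong (s x *_) (*-comm (a u x) (a w x)))
      twice-B : ∑ (λ u → s u * (2 * (a u v * C s u v))) ≡ 2 * B s v
      twice-B = begin
        ∑ (λ u → s u * (2 * (a u v * C s u v)))     ≡⟨ sum-cong-≗ (λ u → swap (s u) (a u v * C s u v)) ⟩
        ∑ (λ u → 2 * (s u * (a u v * C s u v)))     ≡⟨ *-distribˡ-sum 2 (λ u → s u * (a u v * C s u v)) ⟨
        2 * ∑ (λ u → s u * (a u v * C s u v))       ≡⟨ cong (2 *_) (sum-cong-≗ (λ u → cong₂ (λ x y → s u * (x * y)) (a-sym u v) (C-sym u v))) ⟩
        2 * B s v                                   ∎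
        where swap : ∀ x y → x * (2 * y) ≡ 2 * (x * y)
              swap = solve-∀
      arith : ∀ b c t → b + 2 * (0 * c) + (t + 2 * b) ≡ t + 3 * b
      arith = solve-∀

  ι : (Fin n → Bool) → Fin n → ℕ
  ι S x = ind (S x)

  ins : Fin n → (Fin n → Bool) → Fin n → Bool
  ins v S x = does (x ≟ v) ∨ S x

  ι-ins : ∀ {S v} → S v ≡ false → ∀ x → ι (ins v S) x ≡ δ v x + ι S x
  ι-ins {S} {v} Sv≡false x with x ≟ v
  ... | yes refl = cong (λ b → suc (ind b)) (sym Sv≡false)
  ... | no  _    = refl

  ins-here : ∀ v S → ins v S v ≡ true
  ins-here v S with v ≟ v
  ... | yes _   = refl
  ... | no  v≢v = contradiction refl v≢v

  ins-keeps : ∀ {S r} v → S r ≡ true → ins v S r ≡ true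
  ins-keeps {r = r} v Sr = trans (cong (does (r ≟ v) ∨_) Sr) (∨-zeroʳ (does (r ≟ v)))

  size-ins : ∀ {S v} → S v ≡ false → size (ins v S) ≡ suc (size S)
  size-ins {S} {v} Sv≡false = begin
    ∑ (ι (ins v S))                 ≡⟨ sum-cong-≗ (ι-ins Sv≡false) ⟩
    ∑ (λ x → δ v x + ι S x)         ≡⟨ ∑-distrib-+ (δ v) (ι S) ⟩
    ∑ (δ v) + size S                ≡⟨ cong (_+ size S) (trans (sum-cong-≗ (λ x → sym (*-identityʳ (δ v x)))) (∑-δ v (λ _ → 1))) ⟩
    suc (size S)                    ∎
    where open ≡-Reasoning

  size-complement : ∀ S → size (not ∘ S) + size S ≡ n
  size-complement S = trans (sym (∑-distrib-+ (ι (not ∘ S)) (ι S))) (trans (sum-cong-≗ (λ x → one (S x))) (∑-ones n))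
    where one : ∀ b → ind (not b) + ind b ≡ 1
          one true  = refl
          one false = refl

  size-full : ∀ S → size S ≡ n → ∀ x → S x ≡ true
  size-full S |S|≡n x with S x in Sx
  ... | true  = refl
  ... | false = case trans (sym (cong (ind ∘ not) Sx)) (∑≡0⇒≡0 (ι (not ∘ S)) none x) of λ ()
    where none : size (not ∘ S) ≡ 0
          none = +-cancelʳ-≡ (size S) (size (not ∘ S)) 0 (trans (size-complement S) (sym |S|≡n))

  size-outside : ∀ S k → size S + suc k ≡ n → ∃ λ z → S z ≡ false
  size-outside S k |S|+1+k≡n with ∑>0⇒>0 (ι (not ∘ S)) positive
    where positive : 0 < size (not ∘ S)
          positive = subst (0 <_) (sym (+-cancelˡ-≡ (size S) (size (not ∘ S)) (suc k)
                       (trans (+-comm (size S) _) (trans (size-complement S) (sym |S|+1+k≡n))))) (s≤s z≤n)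
  ... | z , pos with S z in Sz
  ...   | false = z , Sz
  ...   | true  = case pos of λ ()

  E-full : ∀ {s} → (∀ x → s x ≡ 1) → E s ≡ ∑ deg
  E-full {s} s≡1 = sum-cong-≗ (λ u → trans (cong (_* D s u) (s≡1 u))
                 (trans (*-identityˡ (D s u)) (sum-cong-≗ (λ w → trans (cong (_* a u w) (s≡1 w)) (*-identityˡ (a u w))))))

  T-full : ∀ {s} → (∀ x → s x ≡ 1) → T s ≡ ∑ wedges
  T-full {s} s≡1 = sum-cong-≗ (λ u → trans (cong (_* B s u) (s≡1 u)) (trans (*-identityˡ (B s u)) (B-full u)))
    where
    one* : ∀ x y → s x * y ≡ y
    one* x y = trans (cong (_* y) (s≡1 x)) (*-identityˡ y)
    B-full : ∀ u → B s u ≡ wedges u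
    B-full u = sum-cong-≗ (λ w → trans (one* w (a u w * C s u w)) (cong (a u w *_) (sum-cong-≗ (λ x → one* x (a u x * a w x)))))

  nbrsIn : (Fin n → Bool) → Fin n → Fin n → Bool
  nbrsIn S v w = S w ∧ adj G v w

  D≡length : ∀ S v → D (ι S) v ≡ length (members (nbrsIn S v))
  D≡length S v = trans (sum-cong-≗ (λ w → sym (ind-∧ (S w) (adj G v w)))) (size≡length (nbrsIn S v))

  B≡pairs : ∀ S v → B (ι S) v ≡ pairs (members (nbrsIn S v))
  B≡pairs S v = trans (sum-cong-≗ entry) (pairsIn≡pairs (nbrsIn S v))
    where
    reassoc : ∀ p q r → p * (q * r) ≡ p * q * r
    reassoc p q r = sym (*-assoc p q r)
    entry : ∀ w → ι S w * (a v w * C (ι S) v w) ≡ ind (nbrsIn S v w) * ∑ (λ x → ind (nbrsIn S v x) * a w x)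
    entry w = trans (reassoc (ι S w) (a v w) _) (cong₂ _*_ (sym (ind-∧ (S w) (adj G v w)))
                (sum-cong-≗ (λ x → trans (reassoc (ι S x) (a v x) (a w x)) (cong (_* a w x) (sym (ind-∧ (S x) (adj G v x)))))))

  D≤deg : ∀ S v → D (ι S) v ≤ deg v
  D≤deg S v = ∑-mono (λ w → subst (_≤ a v w) (ind-∧ (S w) (adj G v w)) (∧-weaker (S w) (adj G v w)))
    where ∧-weaker : ∀ x y → ind (x ∧ y) ≤ ind y
          ∧-weaker true  y = ≤-refl
          ∧-weaker false y = z≤n

-- Three times the clustering coefficient of a vertex of degree d ≤ 3 whose
-- neighbourhood spans m edges: 3m/1 for d = 2, 3m/3 for d = 3, else 0.
thriceC : ℕ → ℕ → ℕ
thriceC 2 m = 3 * m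
thriceC 3 m = m
thriceC _ _ = 0

module ConnectedSubcubic {n : ℕ} (G : Graph n) (connected : Connected G) (6≤n : 6 ≤ n)
                         (deg≤3 : ∀ u → Counting.deg G u ≤ 3) where
  open Counting G
  open Growth G

  -- G contains no K4: a K4 all of whose vertices have degree ≤ 3 would be
  -- a whole component with only 4 < n vertices.
  no-K4 : ∀ {v x y z} → Adj v x → Adj v y → Adj v z → Adj x y → Adj x z → Adj y z → ⊥
  no-K4 vx vy vz xy xz yz = <⇒≱ (≤-trans (s≤s (s≤s (s≤s (s≤s (s≤s z≤n))))) 6≤n)
    (saturated-clique connected K4 (here refl) (λ {p} _ → s≤s (deg≤3 p)))
    where K4 = (vx ∷ vy ∷ vz ∷ []) ∷ (xy ∷ xz ∷ []) ∷ (yz ∷ []) ∷ [] ∷ []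

  no-thin-triangle : ∀ {u p q} → deg u ≤ 2 → deg p ≤ 2 → deg q ≤ 2 → Adj u p → Adj u q → Adj p q → ⊥
  no-thin-triangle {u} {p} {q} du dp dq up uq pq = <⇒≱ (≤-trans (s≤s (s≤s (s≤s (s≤s z≤n)))) 6≤n)
    (saturated-clique connected triangle (here refl) small)
    where
    triangle = (up ∷ uq ∷ []) ∷ (pq ∷ []) ∷ [] ∷ []
    small : ∀ {r} → r ∈ u ∷ p ∷ q ∷ [] → deg r < 3
    small (here refl)                 = s≤s du
    small (there (here refl))         = s≤s dp
    small (there (there (here refl))) = s≤s dq

  -- Among one to three neighbours of a vertex, at most |L| - 1 of the
  -- (unordered) pairs are adjacent; for three this is K4-freeness.
  pairs-bound : ∀ {v} L → All (Adj v) L → 1 ≤ length L → length L ≤ 3 → 2 + pairs L ≤ 2 * length L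
  pairs-bound (x ∷ [])         _ _ _ = ≤-reflexive (cong (2 +_) (pairs-one x))
  pairs-bound (x ∷ y ∷ [])     _ _ _ =
    subst (λ p → 2 + p ≤ 4) (sym (pairs-two x y)) (+-monoʳ-≤ 2 (*-monoʳ-≤ 2 (ind≤1 (adj G x y))))
  pairs-bound (x ∷ y ∷ z ∷ []) (vx ∷ vy ∷ vz ∷ []) _ _ =
    subst (λ p → 2 + p ≤ 6) (sym (pairs-three x y z))
      (+-monoʳ-≤ 2 (*-monoʳ-≤ 2 (at-most-two (adj G x y) (adj G x z) (adj G y z) (no-K4 vx vy vz))))
    where
    at-most-two : ∀ p q r → (p ≡ true → q ≡ true → r ≡ true → ⊥) → ind p + ind q + ind r ≤ 2
    at-most-two true  true  true  not-all with not-all refl refl refl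
    ... | ()
    at-most-two true  true  false _ = ≤-refl
    at-most-two true  false true  _ = ≤-refl
    at-most-two false true  true  _ = ≤-refl
    at-most-two true  false false _ = s≤s z≤n
    at-most-two false true  false _ = s≤s z≤n
    at-most-two false false true  _ = s≤s z≤n
    at-most-two false false false _ = z≤n
  pairs-bound (_ ∷ _ ∷ _ ∷ _ ∷ _) _ _ (s≤s (s≤s (s≤s ())))

  -- Adding a vertex v with d ≥ 1 neighbours in S creates at most d - 1 new triangles.
  new-triangles : ∀ S v → 1 ≤ D (ι S) v → 2 + B (ι S) v ≤ 2 * D (ι S) v
  new-triangles S v d≥1 = subst₂ (λ b d → 2 + b ≤ 2 * d) (sym (B≡pairs S v)) (sym (D≡length S v))
    (pairs-bound L (All.tabulate (λ w∈L → ∧-conicalʳ _ _ (∈-members⁻ w∈L)))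
      (subst (1 ≤_) (D≡length S v) d≥1) (subst (_≤ 3) (D≡length S v) (≤-trans (D≤deg S v) (deg≤3 v))))
    where L = members (nbrsIn S v)

  -- The growth invariant |S| + t(S) ≤ e(S) + 1, written with ordered counts.
  Inv : (Fin n → Bool) → Set
  Inv S = 6 * size S + T (ι S) ≤ 3 * E (ι S) + 6

  inv-ins : ∀ {S v} → S v ≡ false → 1 ≤ D (ι S) v → Inv S → Inv (ins v S)
  inv-ins {S} {v} Sv≡false d≥1 inv-S = begin
    6 * size (ins v S) + T (ι (ins v S))                ≡⟨ cong₂ (λ c t → 6 * c + t) (size-ins Sv≡false) (T-ins (ι-ins Sv≡false)) ⟩
    6 * suc (size S) + (T (ι S) + 3 * B (ι S) v)        ≡⟨ regroup (size S) (T (ι S)) (B (ι S) v) ⟩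
    (6 * size S + T (ι S)) + 3 * (2 + B (ι S) v)        ≤⟨ +-mono-≤ inv-S (*-monoʳ-≤ 3 (new-triangles S v d≥1)) ⟩
    3 * E (ι S) + 6 + 3 * (2 * D (ι S) v)               ≡⟨ regroup′ (E (ι S)) (D (ι S) v) ⟩
    3 * (E (ι S) + 2 * D (ι S) v) + 6                   ≡⟨ cong (λ e → 3 * e + 6) (E-ins (ι-ins Sv≡false)) ⟨
    3 * E (ι (ins v S)) + 6                             ∎
    where
    open ≤-Reasoning
    regroup : ∀ c t b → 6 * suc c + (t + 3 * b) ≡ (6 * c + t) + 3 * (2 + b)
    regroup = solve-∀
    regroup′ : ∀ e d → 3 * e + 6 + 3 * (2 * d) ≡ 3 * (e + 2 * d) + 6
    regroup′ = solve-∀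

  ∅ : Fin n → Bool
  ∅ _ = false

  inv-singleton : ∀ r → Inv (ins r ∅)
  inv-singleton r = subst (_≤ 3 * E (ι (ins r ∅)) + 6) (sym lhs≡6) (m≤n+m 6 (3 * E (ι (ins r ∅))))
    where
    lhs≡6 : 6 * size (ins r ∅) + T (ι (ins r ∅)) ≡ 6
    lhs≡6 = cong₂ (λ c t → 6 * c + t) (trans (size-ins refl) (cong suc (∑-zeros n)))
              (trans (T-ins (ι-ins refl)) (cong₂ (λ t b → t + 3 * b) (∑-zeros n) (∑-zeros n)))

  grow : ∀ k S {r} → size S + k ≡ n → S r ≡ true → Inv S → ∃ λ S′ → (∀ x → S′ x ≡ true) × Inv S′
  grow zero    S     |S|≡n _  inv-S = S , size-full S (trans (sym (+-identityʳ (size S))) |S|≡n) , inv-S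
  grow (suc k) S {r} |S|+k≡n Sr inv-S with size-outside S k |S|+k≡n
  ... | z , Sz≡false with exit (λ x → S x Bool.≟ true) (connected r z) Sr (λ Sz → case trans (sym Sz≡false) Sz of λ ())
  ...   | p , q , Sp , Sq≢true , pq =
    grow k (ins q S) {r} (trans (cong (_+ k) (size-ins Sq)) (trans (sym (+-suc (size S) k)) |S|+k≡n))
         (ins-keeps {S} q Sr) (inv-ins Sq has-nbr inv-S)
    where
    Sq : S q ≡ false
    Sq = ¬-not Sq≢true
    has-nbr : 1 ≤ D (ι S) q
    has-nbr = ≤-trans (≤-reflexive (sym (cong₂ _*_ (cong ind Sp) (Adj⇒a≡1 (Adj-sym pq))))) (∑-point p (λ w → ι S w * a q w))

  edges-vs-triangles : 6 * n + ∑ wedges ≤ 3 * ∑ deg + 6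
  edges-vs-triangles with grow (n ∸ 1) (ins r₀ ∅) {r₀} start (ins-here r₀ ∅) (inv-singleton r₀)
    where
    r₀ : Fin n
    r₀ = fromℕ< (≤-trans (s≤s z≤n) 6≤n)
    start : size (ins r₀ ∅) + (n ∸ 1) ≡ n
    start = trans (cong (_+ (n ∸ 1)) (trans (size-ins refl) (cong suc (∑-zeros n)))) (m+[n∸m]≡n (≤-trans (s≤s z≤n) 6≤n))
  ... | S , everything , inv-S = subst₂ (λ c t → 6 * c + t ≤ 3 * ∑ deg + 6) size≡n (T-full ι≡1)
          (subst (λ e → 6 * size S + T (ι S) ≤ 3 * e + 6) (E-full ι≡1) inv-S)
    where
    ι≡1 : ∀ x → ι S x ≡ 1
    ι≡1 x = cong ind (everything x)
    size≡n : size S ≡ n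
    size≡n = trans (sum-cong-≗ ι≡1) (∑-ones n)

  -- Discharging.  Every simplicial degree-2 vertex sends one unit of charge
  -- to each neighbour of degree 3.
  m : Fin n → ℕ
  m u = nbrEdges G u

  deg3 : Fin n → Bool
  deg3 u = does (deg u ℕ.≟ 3)

  send : Fin n → Fin n → ℕ
  send u v = ind (simplicial₂ u) * a u v * ind (deg3 v)

  sent received : Fin n → ℕ
  sent u     = ∑ (send u)
  received u = ∑ (λ v → send v u)

  received-deg≢3 : ∀ u → ¬ deg u ≡ 3 → received u ≡ 0
  received-deg≢3 u d≢3 = trans (sum-cong-≗ (λ v → trans (cong (λ b → ind (simplicial₂ v) * a v u * ind b) not-deg3)
                                                   (*-zeroʳ (ind (simplicial₂ v) * a v u))))
                                (∑-zeros n)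
    where not-deg3 : deg3 u ≡ false
          not-deg3 = dec-false (deg u ℕ.≟ 3) d≢3

  received≤wedges : ∀ u → received u ≤ wedges u
  received≤wedges u = ∑-mono unit
    where
    unit : ∀ v → send v u ≤ a u v * ∑ (λ w → a u w * a v w)
    unit v with simplicial₂ v in sv | adj G v u in vu
    ... | false | _     = z≤n
    ... | true  | false = z≤n
    ... | true  | true with simplicial₂-common sv vu
    ...   | w , uw , vw = begin
      ind (deg3 u) + 0                        ≡⟨ +-identityʳ _ ⟩
      ind (deg3 u)                            ≤⟨ ind≤1 (deg3 u) ⟩
      1                                       ≡⟨ cong₂ _*_ (Adj⇒a≡1 uw) (Adj⇒a≡1 vw) ⟨
      a u w * a v w                           ≤⟨ ∑-point w (λ w → a u w * a v w) ⟩
      ∑ (λ w → a u w * a v w)                 ≡⟨ *-identityˡ _ ⟨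
      1 * ∑ (λ w → a u w * a v w)             ≡⟨ cong (_* ∑ (λ w → a u w * a v w)) (Adj⇒a≡1 (Adj-sym vu)) ⟨
      a u v * ∑ (λ w → a u w * a v w)         ∎
      where open ≤-Reasoning

  sends-to : ∀ {u v} → simplicial₂ u ≡ true → Adj u v → deg v ≡ 3 → 1 ≤ sent u
  sends-to {u} {v} su uv dv≡3 = ≤-trans (≤-reflexive (sym one)) (∑-point v (send u))
    where one : send u v ≡ 1
          one = cong₂ _*_ (cong₂ _*_ (cong ind su) (Adj⇒a≡1 uv)) (cong ind (dec-true (deg v ℕ.≟ 3) dv≡3))

  deg≢3⇒≤2 : ∀ {v} → ¬ deg v ≡ 3 → deg v ≤ 2
  deg≢3⇒≤2 {v} d≢3 = ≤-pred (≤∧≢⇒< (deg≤3 v) d≢3)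

  -- For degree 2 the only tight case is a simplicial
  -- vertex, which has a neighbour of degree 3 (no-thin-triangle) to pay.
  local-2 : ∀ u → deg u ≡ 2 → 12 * (3 * m u) + 42 + received u ≤ 63 + 14 * m u + sent u
  local-2 u d≡2 with two-nbrs u d≡2
  ... | p , q , N≡pq rewrite received-deg≢3 u (λ d≡3 → case trans (sym d≡2) d≡3 of λ ()) | nbrEdges-two N≡pq
    with adj G p q in pq
  ... | false = ≤-trans (≤ᵇ⇒≤ 42 63 _) (m≤m+n 63 (sent u))
  ... | true  = +-monoʳ-≤ 77 paid
    where
    up : Adj u p
    up = ∈nbrs (subst (p ∈_) (sym N≡pq) (here refl))
    uq : Adj u q
    uq = ∈nbrs (subst (q ∈_) (sym N≡pq) (there (here refl)))
    su : simplicial₂ u ≡ true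
    su = trans (cong adjacent-pair N≡pq) pq
    paid : 1 ≤ sent u
    paid with deg p ℕ.≟ 3 | deg q ℕ.≟ 3
    ... | yes dp≡3 | _        = sends-to su up dp≡3
    ... | no  _    | yes dq≡3 = sends-to su uq dq≡3
    ... | no  dp≢3 | no dq≢3  = contradiction pq
          (no-thin-triangle (≤-reflexive d≡2) (deg≢3⇒≤2 dp≢3) (deg≢3⇒≤2 dq≢3) up uq)

  local-3 : ∀ u → 12 * m u + 63 + received u ≤ 63 + 14 * m u + sent u
  local-3 u = begin
    12 * m u + 63 + received u     ≤⟨ +-monoʳ-≤ (12 * m u + 63) (received≤wedges u) ⟩
    12 * m u + 63 + wedges u       ≡⟨ cong (12 * m u + 63 +_) (wedges≡2*nbrEdges u) ⟩
    12 * m u + 63 + 2 * m u        ≡⟨ regroup (m u) ⟩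
    63 + 14 * m u + 0              ≤⟨ +-monoʳ-≤ (63 + 14 * m u) z≤n ⟩
    63 + 14 * m u + sent u         ∎
    where
    open ≤-Reasoning
    regroup : ∀ k → 12 * k + 63 + 2 * k ≡ 63 + 14 * k + 0
    regroup = solve-∀

  local : ∀ u → 12 * thriceC (deg u) (m u) + 21 * deg u + received u ≤ 63 + 14 * m u + sent u
  local u = by-degree (deg u) refl
    where
    received≡0 : ∀ {d} → deg u ≡ d → ¬ d ≡ 3 → received u ≡ 0
    received≡0 d≡ d≢3 = received-deg≢3 u (d≢3 ∘ trans (sym d≡))
    by-degree : ∀ d → deg u ≡ d → 12 * thriceC d (m u) + 21 * d + received u ≤ 63 + 14 * m u + sent u
    by-degree 0 d≡0 rewrite received≡0 d≡0 (λ ()) = z≤n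
    by-degree 1 d≡1 rewrite received≡0 d≡1 (λ ()) =
      ≤-trans (≤ᵇ⇒≤ 21 63 _) (≤-trans (m≤m+n 63 (14 * m u)) (m≤m+n _ (sent u)))
    by-degree 2 d≡2 = local-2 u d≡2
    by-degree 3 d≡3 = local-3 u
    by-degree (suc (suc (suc (suc _)))) d≡ = case subst (_≤ 3) d≡ (deg≤3 u) of λ { (s≤s (s≤s (s≤s ()))) }

  -- Summing the local inequalities (charge is conserved) and adding seven
  -- times edges-vs-triangles gives  4 Σ_u 3C_u ≤ 7n + 14.
  clustering-sum-bound : 4 * ∑ (λ u → thriceC (deg u) (m u)) ≤ 7 * n + 14
  clustering-sum-bound = *-cancelˡ-≤ 3 (+-cancelʳ-≤ (21 * Δ + R + 42 * n + 14 * M) (3 * (4 * Q)) (3 * (7 * n + 14)) (begin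
    3 * (4 * Q) + (21 * Δ + R + 42 * n + 14 * M)     ≡⟨ regroup Q Δ R n M ⟩
    (12 * Q + 21 * Δ + R) + 7 * (6 * n + 2 * M)       ≤⟨ +-mono-≤ summed-local (*-monoʳ-≤ 7 global) ⟩
    (63 * n + 14 * M + R) + 7 * (3 * Δ + 6)           ≡⟨ regroup′ Q Δ R n M ⟩
    3 * (7 * n + 14) + (21 * Δ + R + 42 * n + 14 * M) ∎))
    where
    open ≤-Reasoning
    Q Δ R M : ℕ
    Q = ∑ (λ u → thriceC (deg u) (m u))
    Δ = ∑ deg
    R = ∑ received
    M = ∑ m
    summed-local : 12 * Q + 21 * Δ + R ≤ 63 * n + 14 * M + R
    summed-local = begin
      12 * Q + 21 * Δ + R                               ≡⟨ ∑-linear 12 21 (λ u → thriceC (deg u) (m u)) deg received ⟨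
      ∑ (λ u → 12 * thriceC (deg u) (m u) + 21 * deg u + received u) ≤⟨ ∑-mono local ⟩
      ∑ (λ u → 63 + 14 * m u + sent u)                  ≡⟨ sum-cong-≗ (λ u → cong (λ c → c + 14 * m u + sent u) (*-identityʳ 63)) ⟨
      ∑ (λ u → 63 * 1 + 14 * m u + sent u)              ≡⟨ ∑-linear 63 14 (λ _ → 1) m sent ⟩
      63 * ∑ {n} (λ _ → 1) + 14 * M + ∑ sent            ≡⟨ cong₂ (λ k s → 63 * k + 14 * M + s) (∑-ones n) (∑-comm send) ⟩
      63 * n + 14 * M + R                               ∎
    global : 6 * n + 2 * M ≤ 3 * Δ + 6
    global = subst (λ w → 6 * n + w ≤ 3 * Δ + 6)
               (trans (sum-cong-≗ wedges≡2*nbrEdges) (sym (*-distribˡ-sum 2 m))) edges-vs-triangles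
    regroup : ∀ Q Δ R n M → 3 * (4 * Q) + (21 * Δ + R + 42 * n + 14 * M) ≡ (12 * Q + 21 * Δ + R) + 7 * (6 * n + 2 * M)
    regroup = solve-∀
    regroup′ : ∀ Q Δ R n M → (63 * n + 14 * M + R) + 7 * (3 * Δ + 6) ≡ 3 * (7 * n + 14) + (21 * Δ + R + 42 * n + 14 * M)
    regroup′ = solve-∀

round-down-4 : ∀ q x → 4 * q ≤ x → 4 * q ≤ x ∸ x % 4
round-down-4 q x 4q≤x = begin
  4 * q               ≡⟨ *-comm 4 q ⟩
  q * 4               ≤⟨ *-monoˡ-≤ 4 q≤x/4 ⟩
  x / 4 * 4           ≡⟨ m+n∸m≡n (x % 4) (x / 4 * 4) ⟨
  x % 4 + x / 4 * 4 ∸ x % 4 ≡⟨ cong (_∸ x % 4) (m≡m%n+[m/n]*n x 4) ⟨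
  x ∸ x % 4           ∎
  where
  open ≤-Reasoning
  q≤x/4 : q ≤ x / 4
  q≤x/4 = subst (_≤ x / 4) (m*n/n≡m q 4) (/-monoˡ-≤ 4 (subst (_≤ x) (*-comm 4 q) 4q≤x))

-- The residue of 7N + 14 mod 4 depends only on N mod 4, and the constant of
-- the theorem is 14 minus that residue.
residue : ∀ N → (7 * N + 14) % 4 ≡ ((3 * (N % 4)) % 4 + 2) % 4
residue N = trans (%-distribˡ-+ (7 * N) 14 4) (cong (λ r → (r + 2) % 4) (%-distribˡ-* 7 N 4))

boundNum+residue : ∀ N → boundNum N + (7 * N + 14) % 4 ≡ 14
boundNum+residue N rewrite residue N with N % 4 | m%n<n N 4
... | 0 | _ = refl
... | 1 | _ = refl
... | 2 | _ = refl
... | 3 | _ = refl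
... | suc (suc (suc (suc _))) | s≤s (s≤s (s≤s (s≤s ())))

sharpen : ∀ N q → 4 * q ≤ 7 * N + 14 → 4 * q ≤ 7 * N + boundNum N
sharpen N q 4q≤ = subst (4 * q ≤_) rounded (round-down-4 q (7 * N + 14) 4q≤)
  where
  open ≡-Reasoning
  r = (7 * N + 14) % 4
  rounded : 7 * N + 14 ∸ r ≡ 7 * N + boundNum N
  rounded = begin
    7 * N + 14 ∸ r                 ≡⟨ cong (λ c → 7 * N + c ∸ r) (boundNum+residue N) ⟨
    7 * N + (boundNum N + r) ∸ r   ≡⟨ cong (_∸ r) (+-assoc (7 * N) (boundNum N) r) ⟨
    7 * N + boundNum N + r ∸ r     ≡⟨ m+n∸n≡m (7 * N + boundNum N) r ⟩
    7 * N + boundNum N             ∎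

[_/1+_] : ℕ → ℕ → ℚᵘ
[ a /1+ d ] = mkℚᵘ (ℤ.+ a) d

/1+-≃ : ∀ {a d b e} → a * suc e ≡ b * suc d → [ a /1+ d ] ≃ [ b /1+ e ]
/1+-≃ {a} {d} {b} {e} eq = *≡* (trans (sym (ℤ.pos-* a (suc e))) (trans (cong ℤ.+_ eq) (ℤ.pos-* b (suc d))))

/1+-≤ : ∀ {a d b e} → a * suc e ≤ b * suc d → [ a /1+ d ] ℚᵘ.≤ [ b /1+ e ]
/1+-≤ {a} {d} {b} {e} le = *≤* (subst₂ ℤ._≤_ (ℤ.pos-* a (suc e)) (ℤ.pos-* b (suc d)) (ℤ.+≤+ le))

/1+-+ : ∀ a d b e → [ a /1+ d ] ℚᵘ.+ [ b /1+ e ] ≃ [ a * suc e + b * suc d /1+ (e + d * suc e) ]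
/1+-+ a d b e = ℚᵘ.≃-reflexive (cong (λ z → mkℚᵘ z (e + d * suc e))
  (trans (cong₂ ℤ._+_ (sym (ℤ.pos-* a (suc e))) (sym (ℤ.pos-* b (suc d)))) (sym (ℤ.pos-+ (a * suc e) (b * suc d)))))

/1+-* : ∀ a d b e → [ a /1+ d ] ℚᵘ.* [ b /1+ e ] ≃ [ a * b /1+ (e + d * suc e) ]
/1+-* a d b e = ℚᵘ.≃-reflexive (cong (λ z → mkℚᵘ z (e + d * suc e)) (sym (ℤ.pos-* a b)))

/1+-+-common : ∀ a b d → [ a /1+ d ] ℚᵘ.+ [ b /1+ d ] ≃ [ a + b /1+ d ]
/1+-+-common a b d = ℚᵘ.≃-trans (/1+-+ a d b d) (/1+-≃ (regroup a b d))
  where regroup : ∀ a b d → (a * suc d + b * suc d) * suc d ≡ (a + b) * suc (d + d * suc d)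
        regroup = solve-∀

toℚᵘ-/ : ∀ a d → ℚ.toℚᵘ (ℤ.+ a ℚ./ suc d) ≃ [ a /1+ d ]
toℚᵘ-/ a d = ℚ.toℚᵘ-fromℚᵘ [ a /1+ d ]

sumℚ-common : ∀ {A : Set} (F : A → ℚ) (h : A → ℕ) d → (∀ x → ℚ.toℚᵘ (F x) ≃ [ h x /1+ d ]) →
              ∀ xs → ℚ.toℚᵘ (sumℚ (map F xs)) ≃ [ sum (map h xs) /1+ d ]
sumℚ-common F h d F≃ []       = *≡* refl
sumℚ-common F h d F≃ (x ∷ xs) = ℚᵘ.≃-trans (ℚ.toℚᵘ-homo-+ (F x) (sumℚ (map F xs)))
  (ℚᵘ.≃-trans (ℚᵘ.+-cong (F≃ x) (sumℚ-common F h d F≃ xs)) (/1+-+-common (h x) (sum (map h xs)) d))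

-- For a vertex of degree at most 3, C_u = 3C_u / 3 = 4·3C_u / 12.
clusteringAt'-≃ : ∀ d k → d ≤ 3 → ℚ.toℚᵘ (clusteringAt' d k) ≃ [ 4 * thriceC d k /1+ 11 ]
clusteringAt'-≃ 0 k _ = *≡* refl
clusteringAt'-≃ 1 k _ = *≡* refl
clusteringAt'-≃ 2 k _ = ℚᵘ.≃-trans (toℚᵘ-/ k 0) (/1+-≃ (scale k))
  where scale : ∀ k → k * 12 ≡ 4 * (3 * k) * 1
        scale = solve-∀
clusteringAt'-≃ 3 k _ = ℚᵘ.≃-trans (toℚᵘ-/ k 2) (/1+-≃ (scale k))
  where scale : ∀ k → k * 12 ≡ 4 * k * 3
        scale = solve-∀
clusteringAt'-≃ (suc (suc (suc (suc _)))) k (s≤s (s≤s (s≤s ())))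

clustering-≃ : ∀ {k} (G : Graph (suc k)) → Subcubic G →
  ℚ.toℚᵘ (clustering G) ≃ [ 4 * ∑ (λ u → thriceC (Counting.deg G u) (nbrEdges G u)) /1+ (11 + k * 12) ]
clustering-≃ {k} G subcubic = ℚᵘ.≃-trans (ℚ.toℚᵘ-homo-* (ℤ.+ 1 ℚ./ suc k) (sumℚ (map (clusteringAt G) (allFin (suc k)))))
  (ℚᵘ.≃-trans (ℚᵘ.*-cong (toℚᵘ-/ 1 k) total)
  (ℚᵘ.≃-trans (/1+-* 1 k (4 * Q) 11) (ℚᵘ.≃-reflexive (cong (λ z → [ z /1+ (11 + k * 12) ]) (*-identityˡ (4 * Q))))))
  where
  open Counting G
  ℓ : Fin (suc k) → ℕ
  ℓ u = thriceC (deg u) (nbrEdges G u)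
  Q = ∑ ℓ
  local : ∀ u → ℚ.toℚᵘ (clusteringAt G u) ≃ [ 4 * ℓ u /1+ 11 ]
  local u = subst (λ d → ℚ.toℚᵘ (clusteringAt G u) ≃ [ 4 * thriceC d (nbrEdges G u) /1+ 11 ]) (degree≡deg u)
              (clusteringAt'-≃ (degree G u) (nbrEdges G u) (subcubic u))
  total : ℚ.toℚᵘ (sumℚ (map (clusteringAt G) (allFin (suc k)))) ≃ [ 4 * Q /1+ 11 ]
  total = ℚᵘ.≃-trans (sumℚ-common (clusteringAt G) (λ u → 4 * ℓ u) 11 local (allFin (suc k)))
            (ℚᵘ.≃-reflexive (cong (λ z → [ z /1+ 11 ]) (trans (sum-allFin (λ u → 4 * ℓ u)) (sym (*-distribˡ-sum 4 ℓ)))))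

bound-≃ : ∀ k → ℚ.toℚᵘ (bound (suc k)) ≃ [ 7 * suc k + boundNum (suc k) /1+ (11 + k * 12) ]
bound-≃ k = ℚᵘ.≃-trans (ℚ.toℚᵘ-homo-+ (ℤ.+ 7 ℚ./ 12) (ℤ.+ c ℚ./ (12 * suc k)))
  (ℚᵘ.≃-trans (ℚᵘ.+-cong (toℚᵘ-/ 7 11) (toℚᵘ-/ c (k + 11 * suc k)))
  (ℚᵘ.≃-trans (/1+-+ 7 11 c (k + 11 * suc k)) (/1+-≃ (common k c))))
  where
  c = boundNum (suc k)
  common : ∀ k c → (7 * suc (k + 11 * suc k) + c * 12) * suc (11 + k * 12)
                   ≡ (7 * suc k + c) * suc (k + 11 * suc k + 11 * suc (k + 11 * suc k))
  common = solve-∀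

theorem2 : ∀ (n : ℕ) (G : Graph n) → 6 Data.Nat.≤ n → Connected G → Subcubic G →
    clustering G Data.Rational.≤ bound n
theorem2 (suc k) G 6≤n connected subcubic =
  ℚ.toℚᵘ-cancel-≤ (ℚᵘ.≤-respˡ-≃ (ℚᵘ.≃-sym (clustering-≃ G subcubic)) (ℚᵘ.≤-respʳ-≃ (ℚᵘ.≃-sym (bound-≃ k))
    (/1+-≤ (*-monoˡ-≤ (suc (11 + k * 12)) (sharpen (suc k) (∑ (λ u → thriceC (deg u) (nbrEdges G u))) clustering-sum-bound)))))
  where
  open Counting G using (deg; degree≡deg)
  open ConnectedSubcubic G connected 6≤n (λ u → subst (_≤ 3) (degree≡deg u) (subcubic u)) using (clustering-sum-bound)
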